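{- For every formula $C$ of $\mathcal{L}$ and all untyped proof terms of $\mathsf{HA}+\mathsf{NEM}$, the following hold: (CR1) if $t\Vdash C$ then $t\in\mathsf{SN}$; (CR2) if $t\Vdash C$ and $t\leadsto^{*} t'$ then $t'\Vdash C$; (CR3) if $t$ is neutral and for every $t'$ with $t\leadsto t'$ we have $t'\Vdash C$, then $t\Vdash C$; (CR4) for all $u,v$: $\mathsf{E}(u,v)\Vdash C$ if and only if $u\Vdash C$ and $v\Vdash C$.
   Context: Terms of the arithmetical language $\mathcal{L}$ are built from numeric variables $\alpha,\beta,\dots$, $0$ and $\mathsf{S}$; a numeral is a closed term $\mathsf{S}\cdots\mathsf{S}0$. There is a predicate symbol for every primitive recursive relation on $\mathbb{N}$; atomic formulas $\mathsf{P}$ are such symbols applied to terms; for atomic $\mathsf{P}$, $\lnot\mathsf{P}$ denotes the atomic formula of the boolean negation of $\mathsf{P}$. Formulas are built from atomic formulas by $\wedge,\vee,\rightarrow,\forall\alpha^{\mathbb N},\exists\alpha^{\mathbb N}$. Untyped proof terms of $\mathsf{HA}+\mathsf{NEM}$: $t,u,v ::= x \mid tu \mid tm \mid \lambda x\, u \mid \lambda\alpha\, u \mid \langle t,u\rangle \mid \pi_0 u \mid \pi_1 u \mid \mathsf{inj}_0(u)\mid \mathsf{inj}_1(u) \mid t[x.u,y.v] \mid (m,t) \mid t[(\alpha,x).u] \mid \mathsf{E}(u,v) \mid \mathsf{H}^{\mathsf P}_\alpha \mid \mathsf{W}^{\mathsf P}_\alpha \mid \mathsf{True} \mid \mathsf{R}\,u\,v\,m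 \mid \mathsf{r}\,t_1\dots t_n$, with $m$ terms of $\mathcal{L}$, $x,y$ proof-term variables, $\mathsf{r}$ a constant. The one-step reduction $\leadsto$ is the closure under all term contexts of: $(\lambda x.u)t\leadsto u[t/x]$; $(\lambda\alpha.u)t\leadsto u[t/\alpha]$ ($t$ term of $\mathcal L$); $\pi_i\langle u_0,u_1\rangle\leadsto u_i$; $\mathsf{inj}_i(u)[x_0.t_0,x_1.t_1]\leadsto t_i[u/x_i]$; $(n,u)[(\alpha,x).v]\leadsto v[n/\alpha][u/x]$ ($n$ numeral); $\mathsf{R}uv0\leadsto u$; $\mathsf{R}uv(\mathsf{S}n)\leadsto vn(\mathsf{R}uvn)$ ($n$ numeral); $(\mathsf{E}(u,v))w\leadsto \mathsf{E}(uw,vw)$; $\pi_i(\mathsf{E}(u,v))\leadsto\mathsf{E}(\pi_iu,\pi_iv)$; $(\mathsf{E}(u,v))[x.w_1,y.w_2]\leadsto\mathsf{E}(u[x.w_1,y.w_2],v[x.w_1,y.w_2])$; $(\mathsf{E}(u,v))[(\alpha,x).w]\leadsto\mathsf{E}(u[(\alpha,x).w],v[(\alpha,x).w])$; $\mathsf{H}^{\mathsf P}_\alpha n\leadsto\mathsf{True}$ if $\mathsf{P}[n/\alpha]$ is true; $\mathsf{W}^{\mathsf P}_\alpha\leadsto(n,\mathsf{True})$ for every numeral $n$; $\mathsf{E}(u,v)\leadsto u$; $\mathsf{E}(u,v)\leadsto v$. $\leadsto^{*}$ is its reflexive-transitive closure; $\mathsf{SN}$ is the set of untyped terms admitting no infinite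 $\leadsto$-reduction sequence. Reducibility $t\Vdash C$ is defined by induction on $C$: $t\Vdash\mathsf{P}$ ($\mathsf P$ atomic) iff $t\in\mathsf{SN}$; $t\Vdash A\wedge B$ iff $\pi_0t\Vdash A$ and $\pi_1t\Vdash B$; $t\Vdash A\rightarrow B$ iff for all $u\Vdash A$, $tu\Vdash B$; $t\Vdash A\vee B$ iff $t\in\mathsf{SN}$ and $t\leadsto^{*}\mathsf{inj}_0(u)$ implies $u\Vdash A$ and $t\leadsto^{*}\mathsf{inj}_1(u)$ implies $u\Vdash B$; $t\Vdash\forall\alpha^{\mathbb N}A$ iff for every term $n$ of $\mathcal L$, $tn\Vdash A[n/\alpha]$; $t\Vdash\exists\alpha^{\mathbb N}A$ iff $t\in\mathsf{SN}$ and for every term $n$ of $\mathcal L$, $t\leadsto^{*}(n,u)$ implies $u\Vdash A[n/\alpha]$. A term is neutral if it is not of the form $\lambda x\,u$, $\lambda\alpha\,u$, $\langle u,t\rangle$, $\mathsf{inj}_i(u)$, $(t,u)$, $\mathsf{E}(u,v)$ or $\mathsf{H}^{\mathsf P}_\alpha$. -}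

module Defs where

open import Data.Nat using (ℕ; zero; suc; _⊔_)
open import Data.Fin using (Fin; zero; suc)
open import Data.Vec using (Vec; []; _∷_; lookup)
import Data.Vec as Vec
open import Data.List using (List; []; _∷_)
open import Data.Maybe using (Maybe; just; nothing)
open import Data.Product using (Σ; _×_; _,_)
open import Data.Unit using (⊤)
open import Data.Empty using (⊥)
open import Relation.Binary.PropositionalEquality using (_≡_; _≢_)
open import Relation.Binary.Construct.Closure.ReflexiveTransitive using (Star)
open import Induction.WellFounded using (Acc)

-- A primitive recursive relation of arity k is given by a code of a
-- primitive recursive function f of arity k; the relation holds at xs
-- iff f(xs) ≢ 0 (f is a characteristic function).

data PR : ℕ → Set where
  Z    : PR 0
  σ    : PR 1
  proj : ∀ {k} → Fin k → PR k
  comp : ∀ {k m} → PR m → Vec (PR k) m → PR k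
  rec  : ∀ {k} → PR k → PR (suc (suc k)) → PR (suc k)

mutual
  ⟦_⟧ : ∀ {k} → PR k → Vec ℕ k → ℕ
  ⟦ Z ⟧ [] = 0
  ⟦ σ ⟧ (x ∷ []) = suc x
  ⟦ proj i ⟧ xs = lookup xs i
  ⟦ comp f gs ⟧ xs = ⟦ f ⟧ (⟦ gs ⟧* xs)
  ⟦ rec f g ⟧ (n ∷ xs) = recAux f g n xs

  ⟦_⟧* : ∀ {k m} → Vec (PR k) m → Vec ℕ k → Vec ℕ m
  ⟦ [] ⟧* xs = []
  ⟦ g ∷ gs ⟧* xs = ⟦ g ⟧ xs ∷ ⟦ gs ⟧* xs

  recAux : ∀ {k} → PR k → PR (suc (suc k)) → ℕ → Vec ℕ k → ℕ
  recAux f g zero xs = ⟦ f ⟧ xs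
  recAux f g (suc n) xs = ⟦ g ⟧ (recAux f g n xs ∷ n ∷ xs)

-- boolean negation of a characteristic function: sḡ ∘ f
sgbar : PR 1
sgbar = rec (comp σ (Z ∷ [])) (comp Z [])

negPR : ∀ {k} → PR k → PR k
negPR f = comp sgbar (f ∷ [])

data LTerm (a : ℕ) : Set where
  lv : Fin a → LTerm a
  l0 : LTerm a
  lS : LTerm a → LTerm a

data IsNumeral {a : ℕ} : LTerm a → Set where
  num0 : IsNumeral l0
  numS : ∀ {n} → IsNumeral n → IsNumeral (lS n)

substL : ∀ {a c} → (Fin a → LTerm c) → LTerm a → LTerm c
substL s (lv i) = s i
substL s l0 = l0
substL s (lS t) = lS (substL s t)

liftL : ∀ {a c} → (Fin a → LTerm c) → Fin (suc a) → LTerm (suc c)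
liftL s zero = lv zero
liftL s (suc i) = substL (λ j → lv (suc j)) (s i)

sub0 : ∀ {a} → LTerm a → Fin (suc a) → LTerm a
sub0 n zero = n
sub0 n (suc i) = lv i

evalL : ∀ {a} → LTerm a → Maybe ℕ
evalL (lv _) = nothing
evalL l0 = just 0
evalL (lS t) with evalL t
... | just n = just (suc n)
... | nothing = nothing

evalVec : ∀ {a k} → Vec (LTerm a) k → Maybe (Vec ℕ k)
evalVec [] = just []
evalVec (t ∷ ts) with evalL t | evalVec ts
... | just n | just ns = just (n ∷ ns)
... | _ | _ = nothing

data Atom (a : ℕ) : Set where
  atom : ∀ {k} → PR k → Vec (LTerm a) k → Atom a

¬ₐ : ∀ {a} → Atom a → Atom a
¬ₐ (atom f ts) = atom (negPR f) ts

substA : ∀ {a c} → (Fin a → LTerm c) → Atom a → Atom c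
substA s (atom f ts) = atom f (Vec.map (substL s) ts)

TrueAtom : ∀ {a} → Atom a → Set
TrueAtom (atom {k} f ts) = Σ (Vec ℕ k) λ xs → (evalVec ts ≡ just xs) × (⟦ f ⟧ xs ≢ 0)

infixr 6 _∧'_
infixr 5 _∨'_
infixr 4 _⇒'_

data Formula : ℕ → Set where
  atm   : ∀ {a} → Atom a → Formula a
  _∧'_  : ∀ {a} → Formula a → Formula a → Formula a
  _∨'_  : ∀ {a} → Formula a → Formula a → Formula a
  _⇒'_  : ∀ {a} → Formula a → Formula a → Formula a
  ∀'    : ∀ {a} → Formula (suc a) → Formula a
  ∃'    : ∀ {a} → Formula (suc a) → Formula a

substF : ∀ {a c} → (Fin a → LTerm c) → Formula a → Formula c
substF s (atm P) = atm (substA s P)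
substF s (A ∧' B) = substF s A ∧' substF s B
substF s (A ∨' B) = substF s A ∨' substF s B
substF s (A ⇒' B) = substF s A ⇒' substF s B
substF s (∀' A) = ∀' (substF (liftL s) A)
substF s (∃' A) = ∃' (substF (liftL s) A)

_[_/α] : ∀ {a} → Formula (suc a) → LTerm a → Formula a
A [ n /α] = substF (sub0 n) A

size : ∀ {a} → Formula a → ℕ
size (atm _) = 1
size (A ∧' B) = suc (size A ⊔ size B)
size (A ∨' B) = suc (size A ⊔ size B)
size (A ⇒' B) = suc (size A ⊔ size B)
size (∀' A) = suc (size A)
size (∃' A) = suc (size A)

-- Untyped proof terms of HA + NEM.
-- PT a b : a = number of free numeric variables in scope,
--          b = number of free proof variables in scope.

data PT : ℕ → ℕ → Set where
  pv     : ∀ {a b} → Fin b → PT a b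
  app    : ∀ {a b} → PT a b → PT a b → PT a b
  appN   : ∀ {a b} → PT a b → LTerm a → PT a b
  lam    : ∀ {a b} → PT a (suc b) → PT a b
  lamN   : ∀ {a b} → PT (suc a) b → PT a b
  pair   : ∀ {a b} → PT a b → PT a b → PT a b
  π₀     : ∀ {a b} → PT a b → PT a b
  π₁     : ∀ {a b} → PT a b → PT a b
  inj₀   : ∀ {a b} → PT a b → PT a b
  inj₁   : ∀ {a b} → PT a b → PT a b
  case   : ∀ {a b} → PT a b → PT a (suc b) → PT a (suc b) → PT a b
  exPair : ∀ {a b} → LTerm a → PT a b → PT a b
  exCase : ∀ {a b} → PT a b → PT (suc a) (suc b) → PT a b
  E      : ∀ {a b} → PT a b → PT a b → PT a b
  H      : ∀ {a b} → Atom (suc a) → PT a b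
  W      : ∀ {a b} → Atom (suc a) → PT a b
  True   : ∀ {a b} → PT a b
  R      : ∀ {a b} → PT a b → PT a b → LTerm a → PT a b
  cst    : ∀ {a b} → ℕ → List (PT a b) → PT a b

mutual
  substN : ∀ {a c b} → (Fin a → LTerm c) → PT a b → PT c b
  substN s (pv x) = pv x
  substN s (app t u) = app (substN s t) (substN s u)
  substN s (appN t m) = appN (substN s t) (substL s m)
  substN s (lam u) = lam (substN s u)
  substN s (lamN u) = lamN (substN (liftL s) u)
  substN s (pair t u) = pair (substN s t) (substN s u)
  substN s (π₀ t) = π₀ (substN s t)
  substN s (π₁ t) = π₁ (substN s t)
  substN s (inj₀ t) = inj₀ (substN s t)
  substN s (inj₁ t) = inj₁ (substN s t)
  substN s (case t u v) = case (substN s t) (substN s u) (substN s v)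
  substN s (exPair m t) = exPair (substL s m) (substN s t)
  substN s (exCase t u) = exCase (substN s t) (substN (liftL s) u)
  substN s (E u v) = E (substN s u) (substN s v)
  substN s (H P) = H (substA (liftL s) P)
  substN s (W P) = W (substA (liftL s) P)
  substN s True = True
  substN s (R u v m) = R (substN s u) (substN s v) (substL s m)
  substN s (cst r ts) = cst r (substN* s ts)

  substN* : ∀ {a c b} → (Fin a → LTerm c) → List (PT a b) → List (PT c b)
  substN* s [] = []
  substN* s (t ∷ ts) = substN s t ∷ substN* s ts

wkN : ∀ {a b} → PT a b → PT (suc a) b
wkN = substN (λ j → lv (suc j))

liftR : ∀ {b d} → (Fin b → Fin d) → Fin (suc b) → Fin (suc d)
liftR ρ zero = zero
liftR ρ (suc i) = suc (ρ i)

mutual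
  renP : ∀ {a b d} → (Fin b → Fin d) → PT a b → PT a d
  renP ρ (pv x) = pv (ρ x)
  renP ρ (app t u) = app (renP ρ t) (renP ρ u)
  renP ρ (appN t m) = appN (renP ρ t) m
  renP ρ (lam u) = lam (renP (liftR ρ) u)
  renP ρ (lamN u) = lamN (renP ρ u)
  renP ρ (pair t u) = pair (renP ρ t) (renP ρ u)
  renP ρ (π₀ t) = π₀ (renP ρ t)
  renP ρ (π₁ t) = π₁ (renP ρ t)
  renP ρ (inj₀ t) = inj₀ (renP ρ t)
  renP ρ (inj₁ t) = inj₁ (renP ρ t)
  renP ρ (case t u v) = case (renP ρ t) (renP (liftR ρ) u) (renP (liftR ρ) v)
  renP ρ (exPair m t) = exPair m (renP ρ t)
  renP ρ (exCase t u) = exCase (renP ρ t) (renP (liftR ρ) u)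
  renP ρ (E u v) = E (renP ρ u) (renP ρ v)
  renP ρ (H P) = H P
  renP ρ (W P) = W P
  renP ρ True = True
  renP ρ (R u v m) = R (renP ρ u) (renP ρ v) m
  renP ρ (cst r ts) = cst r (renP* ρ ts)

  renP* : ∀ {a b d} → (Fin b → Fin d) → List (PT a b) → List (PT a d)
  renP* ρ [] = []
  renP* ρ (t ∷ ts) = renP ρ t ∷ renP* ρ ts

liftP : ∀ {a b d} → (Fin b → PT a d) → Fin (suc b) → PT a (suc d)
liftP s zero = pv zero
liftP s (suc i) = renP suc (s i)

mutual
  substP : ∀ {a b d} → (Fin b → PT a d) → PT a b → PT a d
  substP s (pv x) = s x
  substP s (app t u) = app (substP s t) (substP s u)
  substP s (appN t m) = appN (substP s t) m
  substP s (lam u) = lam (substP (liftP s) u)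
  substP s (lamN u) = lamN (substP (λ i → wkN (s i)) u)
  substP s (pair t u) = pair (substP s t) (substP s u)
  substP s (π₀ t) = π₀ (substP s t)
  substP s (π₁ t) = π₁ (substP s t)
  substP s (inj₀ t) = inj₀ (substP s t)
  substP s (inj₁ t) = inj₁ (substP s t)
  substP s (case t u v) = case (substP s t) (substP (liftP s) u) (substP (liftP s) v)
  substP s (exPair m t) = exPair m (substP s t)
  substP s (exCase t u) = exCase (substP s t) (substP (liftP (λ i → wkN (s i))) u)
  substP s (E u v) = E (substP s u) (substP s v)
  substP s (H P) = H P
  substP s (W P) = W P
  substP s True = True
  substP s (R u v m) = R (substP s u) (substP s v) m
  substP s (cst r ts) = cst r (substP* s ts)

  substP* : ∀ {a b d} → (Fin b → PT a d) → List (PT a b) → List (PT a d)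
  substP* s [] = []
  substP* s (t ∷ ts) = substP s t ∷ substP* s ts

subP0 : ∀ {a b} → PT a b → Fin (suc b) → PT a b
subP0 t zero = t
subP0 t (suc i) = pv i

_[_/x] : ∀ {a b} → PT a (suc b) → PT a b → PT a b
u [ t /x] = substP (subP0 t) u

_[_/αₚ] : ∀ {a b} → PT (suc a) b → LTerm a → PT a b
u [ m /αₚ] = substN (sub0 m) u

infix 3 _↝_ _↝ₗ_

mutual
  data _↝_ {a b : ℕ} : PT a b → PT a b → Set where
    β      : ∀ {u t} → app (lam u) t ↝ u [ t /x]
    βN     : ∀ {u m} → appN (lamN u) m ↝ u [ m /αₚ]
    π₀β    : ∀ {u₀ u₁} → π₀ (pair u₀ u₁) ↝ u₀
    π₁β    : ∀ {u₀ u₁} → π₁ (pair u₀ u₁) ↝ u₁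
    inj₀β  : ∀ {u t₀ t₁} → case (inj₀ u) t₀ t₁ ↝ t₀ [ u /x]
    inj₁β  : ∀ {u t₀ t₁} → case (inj₁ u) t₀ t₁ ↝ t₁ [ u /x]
    exβ    : ∀ {n u v} → IsNumeral n → exCase (exPair n u) v ↝ (v [ n /αₚ]) [ u /x]
    R0     : ∀ {u v} → R u v l0 ↝ u
    RS     : ∀ {u v n} → IsNumeral n → R u v (lS n) ↝ app (appN v n) (R u v n)
    Eapp   : ∀ {u v w} → app (E u v) w ↝ E (app u w) (app v w)
    EappN  : ∀ {u v m} → appN (E u v) m ↝ E (appN u m) (appN v m)
    Eπ₀    : ∀ {u v} → π₀ (E u v) ↝ E (π₀ u) (π₀ v)
    Eπ₁    : ∀ {u v} → π₁ (E u v) ↝ E (π₁ u) (π₁ v)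
    Ecase  : ∀ {u v w₁ w₂} → case (E u v) w₁ w₂ ↝ E (case u w₁ w₂) (case v w₁ w₂)
    EexCase : ∀ {u v w} → exCase (E u v) w ↝ E (exCase u w) (exCase v w)
    Hβ     : ∀ {P n} → IsNumeral n → TrueAtom (substA (sub0 n) P) → appN (H P) n ↝ True
    Wβ     : ∀ {P n} → IsNumeral n → W P ↝ exPair n True
    E₀     : ∀ {u v} → E u v ↝ u
    E₁     : ∀ {u v} → E u v ↝ v
    appₗ   : ∀ {t t' u} → t ↝ t' → app t u ↝ app t' u
    appᵣ   : ∀ {t u u'} → u ↝ u' → app t u ↝ app t u'
    appNₗ  : ∀ {t t' m} → t ↝ t' → appN t m ↝ appN t' m
    lamξ   : ∀ {u u'} → u ↝ u' → lam u ↝ lam u'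
    lamNξ  : ∀ {u u'} → u ↝ u' → lamN u ↝ lamN u'
    pairₗ  : ∀ {t t' u} → t ↝ t' → pair t u ↝ pair t' u
    pairᵣ  : ∀ {t u u'} → u ↝ u' → pair t u ↝ pair t u'
    π₀ξ    : ∀ {t t'} → t ↝ t' → π₀ t ↝ π₀ t'
    π₁ξ    : ∀ {t t'} → t ↝ t' → π₁ t ↝ π₁ t'
    inj₀ξ  : ∀ {t t'} → t ↝ t' → inj₀ t ↝ inj₀ t'
    inj₁ξ  : ∀ {t t'} → t ↝ t' → inj₁ t ↝ inj₁ t'
    case₁  : ∀ {t t' u v} → t ↝ t' → case t u v ↝ case t' u v
    case₂  : ∀ {t u u' v} → u ↝ u' → case t u v ↝ case t u' v
    case₃  : ∀ {t u v v'} → v ↝ v' → case t u v ↝ case t u v'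
    exPairξ : ∀ {m t t'} → t ↝ t' → exPair m t ↝ exPair m t'
    exCase₁ : ∀ {t t' u} → t ↝ t' → exCase t u ↝ exCase t' u
    exCase₂ : ∀ {t u u'} → u ↝ u' → exCase t u ↝ exCase t u'
    Eₗ     : ∀ {u u' v} → u ↝ u' → E u v ↝ E u' v
    Eᵣ     : ∀ {u v v'} → v ↝ v' → E u v ↝ E u v'
    Rₗ     : ∀ {u u' v m} → u ↝ u' → R u v m ↝ R u' v m
    Rᵣ     : ∀ {u v v' m} → v ↝ v' → R u v m ↝ R u v' m
    cstξ   : ∀ {r ts ts'} → ts ↝ₗ ts' → cst r ts ↝ cst r ts'

  data _↝ₗ_ {a b : ℕ} : List (PT a b) → List (PT a b) → Set where
    here  : ∀ {t t' ts} → t ↝ t' → (t ∷ ts) ↝ₗ (t' ∷ ts)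
    there : ∀ {t ts ts'} → ts ↝ₗ ts' → (t ∷ ts) ↝ₗ (t ∷ ts')

infix 3 _↝*_
_↝*_ : ∀ {a b} → PT a b → PT a b → Set
_↝*_ = Star _↝_

SN : ∀ {a b} → PT a b → Set
SN = Acc (λ t' t → t ↝ t')

Neutral : ∀ {a b} → PT a b → Set
Neutral (lam _) = ⊥
Neutral (lamN _) = ⊥
Neutral (pair _ _) = ⊥
Neutral (inj₀ _) = ⊥
Neutral (inj₁ _) = ⊥
Neutral (exPair _ _) = ⊥
Neutral (E _ _) = ⊥
Neutral (H _) = ⊥
Neutral _ = ⊤

-- Reducibility, by induction on the formula.  Since A[n/α] is not a
-- structural subterm of ∀αA, recursion is on a fuel parameter which is
-- initialised to size C (substitution preserves size).

Red : ∀ {a b} → ℕ → PT a b → Formula a → Set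
Red zero t C = ⊤
Red (suc k) t (atm P) = SN t
Red (suc k) t (A ∧' B) = Red k (π₀ t) A × Red k (π₁ t) B
Red (suc k) t (A ⇒' B) = ∀ u → Red k u A → Red k (app t u) B
Red (suc k) t (A ∨' B) =
  SN t × (∀ u → t ↝* inj₀ u → Red k u A) × (∀ u → t ↝* inj₁ u → Red k u B)
Red (suc k) t (∀' A) = ∀ n → Red k (appN t n) (A [ n /α])
Red (suc k) t (∃' A) = SN t × (∀ n u → t ↝* exPair n u → Red k u (A [ n /α]))

infix 3 _⊩_
_⊩_ : ∀ {a b} → PT a b → Formula a → Set
t ⊩ C = Red (size C) t C

-- Girard's reducibility-candidate argument, carried out simultaneously for
-- CR1–CR4 by induction on the size of the formula.  The only new ingredient
-- is the nondeterministic E: it commutes with every elimination, so CR4 at an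
-- elimination formula follows by SN-induction on both components from CR4 at
-- the smaller formula; and a reduction of E(u,v) to an introduction form has
-- to pass through u or through v, which gives CR4 at ∨ and ∃.
module Submission where

open import Defs
open import Data.Product using (_×_)
open import Function.Bundles using (_⇔_)

open import Data.Nat using (ℕ; zero; suc; _⊔_; _≤_)
open import Data.Nat.Properties using (≤-pred; m⊔n≤o⇒m≤o; m⊔n≤o⇒n≤o; ≤-refl)
open import Data.Fin using (Fin)
open import Data.Product using (Σ-syntax; _,_; proj₁; proj₂)
open import Data.Sum using (_⊎_; inj₁; inj₂)
open import Data.Unit using (⊤; tt)
open import Data.Empty using (⊥; ⊥-elim)
open import Function.Bundles using (mk⇔)
open import Relation.Nullary using (¬_)
open import Relation.Binary.PropositionalEquality using (_≡_; refl; sym; subst; cong; cong₂)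
open import Relation.Binary.Construct.Closure.ReflexiveTransitive using (ε; _◅_)
open import Induction.WellFounded using (acc; acc-inverse)

size-substF : ∀ {a c} (s : Fin a → LTerm c) (A : Formula a) → size (substF s A) ≡ size A
size-substF s (atm P) = refl
size-substF s (A ∧' B) = cong suc (cong₂ _⊔_ (size-substF s A) (size-substF s B))
size-substF s (A ∨' B) = cong suc (cong₂ _⊔_ (size-substF s A) (size-substF s B))
size-substF s (A ⇒' B) = cong suc (cong₂ _⊔_ (size-substF s A) (size-substF s B))
size-substF s (∀' A) = cong suc (size-substF (liftL s) A)
size-substF s (∃' A) = cong suc (size-substF (liftL s) A)

size-nonzero : ∀ {a} (C : Formula a) → ¬ size C ≤ 0
size-nonzero (atm _) ()
size-nonzero (_ ∧' _) ()
size-nonzero (_ ∨' _) ()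
size-nonzero (_ ⇒' _) ()
size-nonzero (∀' _) ()
size-nonzero (∃' _) ()

module _ {a b : ℕ} where

  private
    T : Set
    T = PT a b

    variable
      t t' t'' u v w : T

  IsE : T → Set
  IsE (E _ _) = ⊤
  IsE _ = ⊥

  SN-reflect : (f : T → T) → (∀ {t t'} → t ↝ t' → f t ↝ f t') → SN (f t) → SN t
  SN-reflect f f-cong (acc rs) = acc λ s → SN-reflect f f-cong (rs (f-cong s))

  SN-E : SN u → SN v → SN (E u v)
  SN-E (acc ru) (acc rv) = acc λ where
    E₀ → acc ru
    E₁ → acc rv
    (Eₗ s) → SN-E (ru s) (acc rv)
    (Eᵣ s) → SN-E (acc ru) (rv s)

  True-normal : ¬ (True ↝ t)
  True-normal ()

  ↝*-preserves : (P : T → Set) → (∀ {t t'} → P t → t ↝ t' → P t') → P t → t ↝* t' → P t'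
  ↝*-preserves P step p ε = p
  ↝*-preserves P step p (s ◅ r) = ↝*-preserves P step (step p s) r

  ↝*-from-neutral : Neutral t → ¬ Neutral t'' → t ↝* t'' → Σ[ t' ∈ T ] (t ↝ t' × t' ↝* t'')
  ↝*-from-neutral n ¬n ε = ⊥-elim (¬n n)
  ↝*-from-neutral n ¬n (s ◅ r) = _ , s , r

  E↝*-split : E u v ↝* t → ¬ IsE t → u ↝* t ⊎ v ↝* t
  E↝*-split ε ¬E = ⊥-elim (¬E tt)
  E↝*-split (E₀ ◅ r) ¬E = inj₁ r
  E↝*-split (E₁ ◅ r) ¬E = inj₂ r
  E↝*-split (Eₗ s ◅ r) ¬E with E↝*-split r ¬E
  ... | inj₁ r' = inj₁ (s ◅ r')
  ... | inj₂ r' = inj₂ r'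
  E↝*-split (Eᵣ s ◅ r) ¬E with E↝*-split r ¬E
  ... | inj₁ r' = inj₁ r'
  ... | inj₂ r' = inj₂ (s ◅ r')

  -- head covers the redexes fired by an introduction form t; it carries no
  -- more information because it only ever occurs in refuted cases.
  data ElimStep (f : T → T) : T → T → Set where
    inner : t ↝ t' → ElimStep f t (f t')
    pushE : ElimStep f (E u v) (E (f u) (f v))
    head  : ¬ Neutral t → ¬ IsE t → ElimStep f t t''

  record Eliminator (f : T → T) : Set where
    field
      neutral    : ∀ {t} → Neutral (f t)
      congruence : ∀ {t t'} → t ↝ t' → f t ↝ f t'
      inversion  : ∀ {t t''} → f t ↝ t'' → ElimStep f t t''

  π₀-eliminator : Eliminator π₀
  π₀-eliminator = record { neutral = tt ; congruence = π₀ξ ; inversion = inv }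
    where
    inv : π₀ t ↝ t'' → ElimStep π₀ t t''
    inv (π₀ξ s) = inner s
    inv π₀β = head (λ ()) (λ ())
    inv Eπ₀ = pushE

  π₁-eliminator : Eliminator π₁
  π₁-eliminator = record { neutral = tt ; congruence = π₁ξ ; inversion = inv }
    where
    inv : π₁ t ↝ t'' → ElimStep π₁ t t''
    inv (π₁ξ s) = inner s
    inv π₁β = head (λ ()) (λ ())
    inv Eπ₁ = pushE

  appN-eliminator : (m : LTerm a) → Eliminator (λ t → appN t m)
  appN-eliminator m = record { neutral = tt ; congruence = appNₗ ; inversion = inv }
    where
    inv : appN t m ↝ t'' → ElimStep (λ t → appN t m) t t''
    inv (appNₗ s) = inner s
    inv βN = head (λ ()) (λ ())
    inv EappN = pushE
    inv (Hβ _ _) = head (λ ()) (λ ())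

  elim-neutral-reducts : ∀ {f} → Eliminator f → (P : T → Set) → Neutral t →
                         (∀ t' → t ↝ t' → P (f t')) → ∀ t'' → f t ↝ t'' → P t''
  elim-neutral-reducts e P n h t'' s with Eliminator.inversion e s
  ... | inner s' = h _ s'
  ... | head ¬n _ = ⊥-elim (¬n n)

  -- CRi k states CRi for every formula of size ≤ k, at fuel k: the clauses
  -- of Red (suc k) call Red k on components whose size is merely bounded by k.
  CR1 CR2 CR3 CR4 : ℕ → Set
  CR1 k = (C : Formula a) → size C ≤ k → (t : T) → Red k t C → SN t
  CR2 k = (C : Formula a) → size C ≤ k → ∀ {t t' : T} → Red k t C → t ↝ t' → Red k t' C
  CR3 k = (C : Formula a) → size C ≤ k → (t : T) → Neutral t → (∀ t' → t ↝ t' → Red k t' C) → Red k t C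
  CR4 k = (C : Formula a) → size C ≤ k → ∀ {u v : T} → Red k u C → Red k v C → Red k (E u v) C

  record CR (k : ℕ) : Set where
    field
      cr1 : CR1 k
      cr2 : CR2 k
      cr3 : CR3 k
      cr4 : CR4 k

  CR-zero : CR 0
  CR-zero = record
    { cr1 = λ C le → ⊥-elim (size-nonzero C le)
    ; cr2 = λ C le → ⊥-elim (size-nonzero C le)
    ; cr3 = λ C le → ⊥-elim (size-nonzero C le)
    ; cr4 = λ C le → ⊥-elim (size-nonzero C le)
    }

  module CR-suc (k : ℕ) (ih : CR k) where
    open CR ih

    fuelˡ : ∀ {A B : Formula a} → suc (size A ⊔ size B) ≤ suc k → size A ≤ k
    fuelˡ {A} {B} le = m⊔n≤o⇒m≤o (size A) (size B) (≤-pred le)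

    fuelʳ : ∀ {A B : Formula a} → suc (size A ⊔ size B) ≤ suc k → size B ≤ k
    fuelʳ {A} {B} le = m⊔n≤o⇒n≤o (size A) (size B) (≤-pred le)

    fuel-instance : ∀ {A : Formula (suc a)} n → suc (size A) ≤ suc k → size (A [ n /α]) ≤ k
    fuel-instance {A} n le = subst (_≤ k) (sym (size-substF (sub0 n) A)) (≤-pred le)

    -- b may be 0, so there need not be a proof variable: the neutral normal
    -- form True plays its role.
    True-reducible : (C : Formula a) → size C ≤ k → Red k True C
    True-reducible C le = cr3 C le True tt λ _ s → ⊥-elim (True-normal s)

    elim-CR3 : ∀ {f} → Eliminator f → (A : Formula a) → size A ≤ k → Neutral t →
               (∀ t' → t ↝ t' → Red k (f t') A) → Red k (f t) A
    elim-CR3 e A le n h =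
      cr3 A le _ (Eliminator.neutral e) (elim-neutral-reducts e (λ x → Red k x A) n h)

    elim-CR4 : ∀ {f} → Eliminator f → (A : Formula a) → size A ≤ k → SN u → SN v →
               Red k (f u) A → Red k (f v) A → Red k (f (E u v)) A
    elim-CR4 {u = u} {v = v} {f = f} e A le (acc ru) (acc rv) xu xv =
      cr3 A le _ (Eliminator.neutral e) reducts
      where
      open Eliminator e
      reducts : ∀ t'' → f (E u v) ↝ t'' → Red k t'' A
      reducts t'' s with inversion s
      ... | inner E₀ = xu
      ... | inner E₁ = xv
      ... | inner (Eₗ s') = elim-CR4 e A le (ru s') (acc rv) (cr2 A le xu (congruence s')) xv
      ... | inner (Eᵣ s') = elim-CR4 e A le (acc ru) (rv s') xu (cr2 A le xv (congruence s'))
      ... | pushE = cr4 A le xu xv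
      ... | head _ ¬E = ⊥-elim (¬E tt)

    cr1S : CR1 (suc k)
    cr1S (atm P) le t p = p
    cr1S (A ∧' B) le t p = SN-reflect π₀ π₀ξ (cr1 A (fuelˡ {A} {B} le) _ (proj₁ p))
    cr1S (A ∨' B) le t p = proj₁ p
    cr1S (A ⇒' B) le t p = SN-reflect (λ x → app x True) appₗ
      (cr1 B (fuelʳ {A} {B} le) _ (p True (True-reducible A (fuelˡ {A} {B} le))))
    cr1S (∀' A) le t p = SN-reflect (λ x → appN x l0) appNₗ (cr1 _ (fuel-instance {A} l0 le) _ (p l0))
    cr1S (∃' A) le t p = proj₁ p

    cr2S : CR2 (suc k)
    cr2S (atm P) le p s = acc-inverse p s
    cr2S (A ∧' B) le (p , q) s = cr2 A (fuelˡ {A} {B} le) p (π₀ξ s) , cr2 B (fuelʳ {A} {B} le) q (π₁ξ s)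
    cr2S (A ∨' B) le (sn , p , q) s = acc-inverse sn s , (λ u r → p u (s ◅ r)) , (λ u r → q u (s ◅ r))
    cr2S (A ⇒' B) le p s u q = cr2 B (fuelʳ {A} {B} le) (p u q) (appₗ s)
    cr2S (∀' A) le p s n = cr2 _ (fuel-instance {A} n le) (p n) (appNₗ s)
    cr2S (∃' A) le (sn , p) s = acc-inverse sn s , λ n u r → p n u (s ◅ r)

    app-neutral-CR3 : ∀ {A B} → size A ≤ k → size B ≤ k → Neutral t →
                      (∀ t' → t ↝ t' → Red (suc k) t' (A ⇒' B)) →
                      SN w → Red k w A → Red k (app t w) B
    app-neutral-CR3 {t = t} {w = w} {A = A} {B = B} la lb n h (acc rw) q = cr3 B lb _ tt reducts
      where
      reducts : ∀ t'' → app t w ↝ t'' → Red k t'' B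
      reducts _ (appₗ s) = h _ s w q
      reducts _ (appᵣ s) = app-neutral-CR3 la lb n h (rw s) (cr2 A la q s)
      reducts _ β = ⊥-elim n
      reducts _ Eapp = ⊥-elim n

    cr3S : CR3 (suc k)
    cr3S (atm P) le t n h = acc λ s → h _ s
    cr3S (A ∧' B) le t n h =
        elim-CR3 π₀-eliminator A (fuelˡ {A} {B} le) n (λ t' s → proj₁ (h t' s))
      , elim-CR3 π₁-eliminator B (fuelʳ {A} {B} le) n (λ t' s → proj₂ (h t' s))
    cr3S (A ∨' B) le t n h = acc (λ s → proj₁ (h _ s)) , left , right
      where
      left : ∀ u → t ↝* inj₀ u → Red k u A
      left u r with ↝*-from-neutral n (λ ()) r
      ... | t' , s , r' = proj₁ (proj₂ (h t' s)) u r'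
      right : ∀ u → t ↝* inj₁ u → Red k u B
      right u r with ↝*-from-neutral n (λ ()) r
      ... | t' , s , r' = proj₂ (proj₂ (h t' s)) u r'
    cr3S (A ⇒' B) le t n h u q =
      app-neutral-CR3 (fuelˡ {A} {B} le) (fuelʳ {A} {B} le) n h (cr1 A (fuelˡ {A} {B} le) u q) q
    cr3S (∀' A) le t n h m =
      elim-CR3 (appN-eliminator m) (A [ m /α]) (fuel-instance {A} m le) n (λ t' s → h t' s m)
    cr3S (∃' A) le t n h = acc (λ s → proj₁ (h _ s)) , witnesses
      where
      witnesses : ∀ m u → t ↝* exPair m u → Red k u (A [ m /α])
      witnesses m u r with ↝*-from-neutral n (λ ()) r
      ... | t' , s , r' = proj₂ (h t' s) m u r'

    app-E-CR4 : ∀ {A B} → (le : size (A ⇒' B) ≤ suc k) → SN u → SN v → SN w →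
                Red (suc k) u (A ⇒' B) → Red (suc k) v (A ⇒' B) → Red k w A →
                Red k (app (E u v) w) B
    app-E-CR4 {u = u} {v = v} {w = w} {A = A} {B = B} le (acc ru) (acc rv) (acc rw) xu xv q =
      cr3 B lb _ tt reducts
      where
      la = fuelˡ {A} {B} le
      lb = fuelʳ {A} {B} le
      reducts : ∀ t'' → app (E u v) w ↝ t'' → Red k t'' B
      reducts _ (appₗ E₀) = xu w q
      reducts _ (appₗ E₁) = xv w q
      reducts _ (appₗ (Eₗ s)) = app-E-CR4 le (ru s) (acc rv) (acc rw) (cr2S (A ⇒' B) le xu s) xv q
      reducts _ (appₗ (Eᵣ s)) = app-E-CR4 le (acc ru) (rv s) (acc rw) xu (cr2S (A ⇒' B) le xv s) q
      reducts _ (appᵣ s) = app-E-CR4 le (acc ru) (acc rv) (rw s) xu xv (cr2 A la q s)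
      reducts _ Eapp = cr4 B lb (xu w q) (xv w q)

    cr4S : CR4 (suc k)
    cr4S (atm P) le p q = SN-E p q
    cr4S (A ∧' B) le {u} {v} p q =
        elim-CR4 π₀-eliminator A (fuelˡ {A} {B} le) snu snv (proj₁ p) (proj₁ q)
      , elim-CR4 π₁-eliminator B (fuelʳ {A} {B} le) snu snv (proj₂ p) (proj₂ q)
      where
      snu = cr1S (A ∧' B) le u p
      snv = cr1S (A ∧' B) le v q
    cr4S (A ∨' B) le {u} {v} (su , p₀ , p₁) (sv , q₀ , q₁) = SN-E su sv , left , right
      where
      left : ∀ w → E u v ↝* inj₀ w → Red k w A
      left w r with E↝*-split r (λ ())
      ... | inj₁ r' = p₀ w r'
      ... | inj₂ r' = q₀ w r'
      right : ∀ w → E u v ↝* inj₁ w → Red k w B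
      right w r with E↝*-split r (λ ())
      ... | inj₁ r' = p₁ w r'
      ... | inj₂ r' = q₁ w r'
    cr4S (A ⇒' B) le {u} {v} p q w r =
      app-E-CR4 {A = A} {B} le (cr1S (A ⇒' B) le u p) (cr1S (A ⇒' B) le v q)
        (cr1 A (fuelˡ {A} {B} le) w r) p q r
    cr4S (∀' A) le {u} {v} p q n =
      elim-CR4 (appN-eliminator n) (A [ n /α]) (fuel-instance {A} n le)
        (cr1S (∀' A) le u p) (cr1S (∀' A) le v q) (p n) (q n)
    cr4S (∃' A) le {u} {v} (su , p) (sv , q) = SN-E su sv , witnesses
      where
      witnesses : ∀ n w → E u v ↝* exPair n w → Red k w (A [ n /α])
      witnesses n w r with E↝*-split r (λ ())
      ... | inj₁ r' = p n w r'
      ... | inj₂ r' = q n w r'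

    CR-next : CR (suc k)
    CR-next = record { cr1 = cr1S ; cr2 = cr2S ; cr3 = cr3S ; cr4 = cr4S }

  CR-all : ∀ k → CR k
  CR-all zero = CR-zero
  CR-all (suc k) = CR-suc.CR-next k (CR-all k)

mainTheorem2 : ∀ {a b} (C : Formula a) →
    (∀ (t : PT a b) → t ⊩ C → SN t)
    × (∀ (t t' : PT a b) → t ⊩ C → t ↝* t' → t' ⊩ C)
    × (∀ (t : PT a b) → Neutral t → (∀ t' → t ↝ t' → t' ⊩ C) → t ⊩ C)
    × (∀ (u v : PT a b) → (E u v ⊩ C) ⇔ (u ⊩ C × v ⊩ C))
mainTheorem2 {a} {b} C =
    (λ t → cr1 C ≤-refl t)
  , (λ t t' → ↝*-preserves (_⊩ C) (cr2 C ≤-refl))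
  , (λ t → cr3 C ≤-refl t)
  , (λ u v → mk⇔ (λ e → cr2 C ≤-refl e E₀ , cr2 C ≤-refl e E₁)
                 (λ (p , q) → cr4 C ≤-refl p q))
  where
  open CR (CR-all {a} {b} (size C))
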